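{- Let $p$ be an element of a join-semilattice $S$. Then the minimal neighborhoods of $p$ are exactly the sets of the form $\{x\in S:x\le p\}\setminus\boldsymbol{a}$, where $\boldsymbol{a}$ ranges over maximal proper ideals of $\{x\in S:x\le p\}$. In particular, every minimal neighborhood of $p$ is clopen.
   Context: On a join-semilattice $S$, let $\varphi(\boldsymbol{x})$ be the set of joins of nonempty finite subsets of $\boldsymbol{x}$; the interior is $\check\varphi(\boldsymbol{x})=S\setminus\varphi(S\setminus\boldsymbol{x})$. A set is closed if $\varphi(\boldsymbol{x})=\boldsymbol{x}$, open if $\check\varphi(\boldsymbol{x})=\boldsymbol{x}$, clopen if both. A neighborhood of $p$ is a set $\boldsymbol{u}$ with $p\in\check\varphi(\boldsymbol{u})$; a minimal neighborhood is one minimal under inclusion. An ideal of a join-semilattice is a (possibly empty) lower subset closed under finite joins; the empty set is allowed as an ideal. -}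

module Defs where

open import Level using (Level)
open import Data.Product using (Σ; ∃; _×_; _,_)
open import Data.List using (List; foldr)
open import Data.List.Relation.Unary.All using (All)
open import Relation.Binary.Core using (Rel)
open import Relation.Binary.PropositionalEquality using (_≡_)
open import Relation.Unary using (Pred; _∈_; _∉_; _⊆_; _≐_; ∁; _∖_)
open import Algebra.Core using (Op₂)

module JS {a : Level} {A : Set a} (_≤_ : Rel A a) (_∨_ : Op₂ A) where

  -- φ(x): the set of joins of nonempty finite subsets of x
  -- (a nonempty finite subset is presented as a nonempty list y ∷ ys of elements of x).
  φ : Pred A a → Pred A a
  φ x z = Σ A λ y → Σ (List A) λ ys → (y ∈ x) × All (_∈ x) ys × (foldr _∨_ y ys ≡ z)

  φ̌ : Pred A a → Pred A a
  φ̌ x = ∁ (φ (∁ x))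

  Closed : Pred A a → Set a
  Closed x = φ x ≐ x

  Open : Pred A a → Set a
  Open x = φ̌ x ≐ x

  Clopen : Pred A a → Set a
  Clopen x = Closed x × Open x

  Neighborhood : A → Pred A a → Set a
  Neighborhood p u = p ∈ φ̌ u

  MinimalNeighborhood : A → Pred A a → Set (Level.suc a)
  MinimalNeighborhood p u =
    Neighborhood p u × (∀ (v : Pred A a) → Neighborhood p v → v ⊆ u → u ⊆ v)

  ↓ : A → Pred A a
  ↓ p x = x ≤ p

  -- an ideal of the join-semilattice ↓p: a (possibly empty) subset of ↓p,
  -- lower in ↓p, closed under (binary, hence nonempty finite) joins
  IdealOf↓ : A → Pred A a → Set a
  IdealOf↓ p I =
    (I ⊆ ↓ p)
    × (∀ {x y} → x ≤ y → y ∈ I → x ∈ I)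
    × (∀ {x y} → x ∈ I → y ∈ I → (x ∨ y) ∈ I)

  ProperIdealOf↓ : A → Pred A a → Set a
  ProperIdealOf↓ p I = IdealOf↓ p I × (∃ λ x → x ∈ ↓ p × x ∉ I)

  MaximalProperIdealOf↓ : A → Pred A a → Set (Level.suc a)
  MaximalProperIdealOf↓ p I =
    ProperIdealOf↓ p I × (∀ (J : Pred A a) → ProperIdealOf↓ p J → I ⊆ J → J ⊆ I)

-- Neighborhoods of p correspond to proper ideals of ↓p: u is a neighborhood of p exactly
-- when p does not lie in the ideal ⟨↓p ∖ u⟩ generated by the points of ↓p outside u, and
-- conversely ↓p ∖ I is a neighborhood of p for every ideal I ∌ p. Both passages reverse
-- inclusion, so minimal neighborhoods correspond to maximal proper ideals. A set ↓p ∖ I is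
-- closed because I is a lower set, and open because a join of points outside ↓p ∖ I lying
-- below p stays inside the join-closed set I.
module Submission where

open import Defs
open import Level using (Level)
open import Data.Product using (Σ; ∃; _×_; _,_; proj₁; proj₂)
open import Data.List using (List; []; _∷_; _++_; foldr)
open import Data.List.Relation.Unary.All using (All; []; _∷_) renaming (map to All-map)
open import Data.List.Relation.Unary.All.Properties using (++⁺; ++⁻)
open import Relation.Nullary.Decidable using (decidable-stable)
open import Relation.Binary.Core using (Rel)
open import Relation.Binary.PropositionalEquality using (_≡_; refl; subst)
open import Relation.Binary.Lattice.Structures using (IsJoinSemilattice)
open import Relation.Unary using (Pred; _∈_; _∉_; _⊆_; _≐_; _∩_; _∖_; ∁)
open import Relation.Unary.Properties using (≐-sym)
open import Algebra.Core using (Op₂)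
open import Axiom.ExcludedMiddle using (ExcludedMiddle)

module Neighborhoods {a : Level} {A : Set a} {_≤_ : Rel A a} {_∨_ : Op₂ A}
  (isJoinSemilattice : IsJoinSemilattice _≡_ _≤_ _∨_) where

  open JS _≤_ _∨_
  open IsJoinSemilattice isJoinSemilattice
    using (antisym; x≤x∨y; y≤x∨y; ∨-least)
    renaming (refl to ≤-refl; trans to ≤-trans)

  JoinClosed : Pred A a → Set a
  JoinClosed I = ∀ {x y} → x ∈ I → y ∈ I → (x ∨ y) ∈ I

  ↓-joinClosed : ∀ p → JoinClosed (↓ p)
  ↓-joinClosed p = ∨-least

  foldr-∨-seed : ∀ y ys → y ≤ foldr _∨_ y ys
  foldr-∨-seed y []       = ≤-refl
  foldr-∨-seed y (x ∷ ys) = ≤-trans (foldr-∨-seed y ys) (y≤x∨y x _)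

  foldr-∨-upper : ∀ y ys → All (_≤ foldr _∨_ y ys) ys
  foldr-∨-upper y []       = []
  foldr-∨-upper y (x ∷ ys) =
    x≤x∨y x _ ∷ All-map (λ x≤ → ≤-trans x≤ (y≤x∨y x _)) (foldr-∨-upper y ys)

  foldr-∨-least : ∀ {w} y ys → y ≤ w → All (_≤ w) ys → foldr _∨_ y ys ≤ w
  foldr-∨-least y []       y≤w []           = y≤w
  foldr-∨-least y (x ∷ ys) y≤w (x≤w ∷ ys≤w) = ∨-least x≤w (foldr-∨-least y ys y≤w ys≤w)

  foldr-∨-closed : ∀ {I} → JoinClosed I →
                   ∀ y ys → y ∈ I → All (_∈ I) ys → foldr _∨_ y ys ∈ I
  foldr-∨-closed cl y []       y∈I []             = y∈I
  foldr-∨-closed cl y (x ∷ ys) y∈I (x∈I ∷ ys∈I) = cl x∈I (foldr-∨-closed cl y ys y∈I ys∈I)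

  φ-extensive : ∀ {X} → X ⊆ φ X
  φ-extensive {x = x} x∈X = x , [] , x∈X , [] , refl

  φ-mono : ∀ {X Y} → X ⊆ Y → φ X ⊆ φ Y
  φ-mono X⊆Y (y , ys , y∈X , ys∈X , eq) = y , ys , X⊆Y y∈X , All-map X⊆Y ys∈X , eq

  JoinClosed⇒φ⊆ : ∀ {I} → JoinClosed I → φ I ⊆ I
  JoinClosed⇒φ⊆ cl (y , ys , y∈I , ys∈I , refl) = foldr-∨-closed cl y ys y∈I ys∈I

  φ-restrict : ∀ {X z} → z ∈ φ X → z ∈ φ (↓ z ∩ X)
  φ-restrict (y , ys , y∈X , ys∈X , refl) =
    y , ys , (foldr-∨-seed y ys , y∈X) , zipBelow ys (foldr-∨-upper y ys) ys∈X , refl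
    where
    zipBelow : ∀ {X w} xs → All (_≤ w) xs → All (_∈ X) xs → All (_∈ ↓ w ∩ X) xs
    zipBelow []       []           []             = []
    zipBelow (x ∷ xs) (x≤w ∷ xs≤w) (x∈X ∷ xs∈X) = (x≤w , x∈X) ∷ zipBelow xs xs≤w xs∈X

  φ-joinClosed : ∀ {X} → JoinClosed (φ X)
  φ-joinClosed (y , ys , y∈X , ys∈X , refl) (y′ , ys′ , y′∈X , ys′∈X , refl) =
    y′ , zs , y′∈X , ++⁺ ys∈X (y∈X ∷ ys′∈X) , antisym t≤z∨w z∨w≤t
    where
    zs : List A
    zs = ys ++ y ∷ ys′
    z w t : A
    z = foldr _∨_ y ys
    w = foldr _∨_ y′ ys′
    t = foldr _∨_ y′ zs
    z∨w≤t : (z ∨ w) ≤ t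
    z∨w≤t with ys≤t , y≤t ∷ ys′≤t ← ++⁻ ys (foldr-∨-upper y′ zs) =
      ∨-least (foldr-∨-least y ys y≤t ys≤t) (foldr-∨-least y′ ys′ (foldr-∨-seed y′ zs) ys′≤t)
    z≤z∨w : z ≤ (z ∨ w)
    z≤z∨w = x≤x∨y z w
    w≤z∨w : w ≤ (z ∨ w)
    w≤z∨w = y≤x∨y z w
    t≤z∨w : t ≤ (z ∨ w)
    t≤z∨w = foldr-∨-least y′ zs (≤-trans (foldr-∨-seed y′ ys′) w≤z∨w)
      (++⁺ (All-map (λ x≤z → ≤-trans x≤z z≤z∨w) (foldr-∨-upper y ys))
           (≤-trans (foldr-∨-seed y ys) z≤z∨w
             ∷ All-map (λ x≤w → ≤-trans x≤w w≤z∨w) (foldr-∨-upper y′ ys′)))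

  φ̌-mono : ∀ {X Y} → X ⊆ Y → φ̌ X ⊆ φ̌ Y
  φ̌-mono X⊆Y z∉φ∁X z∈φ∁Y = z∉φ∁X (φ-mono (λ x∉Y x∈X → x∉Y (X⊆Y x∈X)) z∈φ∁Y)

  neighborhood-⊇ : ∀ {p u v} → Neighborhood p u → u ⊆ v → Neighborhood p v
  neighborhood-⊇ nbhd u⊆v = φ̌-mono u⊆v nbhd

  Clopen-resp-≐ : ∀ {X Y} → X ≐ Y → Clopen X → Clopen Y
  Clopen-resp-≐ (X⊆Y , Y⊆X) ((φX⊆X , X⊆φX) , (φ̌X⊆X , X⊆φ̌X)) =
    ((λ z∈φY → X⊆Y (φX⊆X (φ-mono Y⊆X z∈φY))) , (λ z∈Y → φ-mono X⊆Y (X⊆φX (Y⊆X z∈Y)))) ,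
    ((λ z∈φ̌Y → X⊆Y (φ̌X⊆X (φ̌-mono Y⊆X z∈φ̌Y))) , (λ z∈Y → φ̌-mono X⊆Y (X⊆φ̌X (Y⊆X z∈Y))))

  MinimalNeighborhood-resp-≐ : ∀ {p X Y} → X ≐ Y →
                               MinimalNeighborhood p X → MinimalNeighborhood p Y
  MinimalNeighborhood-resp-≐ (X⊆Y , Y⊆X) (nbhd , minimal) =
    neighborhood-⊇ nbhd X⊆Y ,
    λ v nbhdᵥ v⊆Y z∈Y → minimal v nbhdᵥ (λ z∈v → Y⊆X (v⊆Y z∈v)) (Y⊆X z∈Y)

  neighborhood-of-joinClosed : ∀ {I u z} → JoinClosed I → z ∉ I → ↓ z ∖ u ⊆ I →
                               Neighborhood z u
  neighborhood-of-joinClosed cl z∉I ↓z∖u⊆I z∈φ∁u =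
    z∉I (JoinClosed⇒φ⊆ cl (φ-mono ↓z∖u⊆I (φ-restrict z∈φ∁u)))

  proper⇒∌ : ∀ {p I} → ProperIdealOf↓ p I → p ∉ I
  proper⇒∌ ((_ , lower , _) , x , x≤p , x∉I) p∈I = x∉I (lower x≤p p∈I)

  module GeneratedIdeal (p : A) where

    ⟨_⟩ : Pred A a → Pred A a
    ⟨ X ⟩ x = x ≤ p × ∃ λ z → z ∈ φ X × x ≤ z

    ⟨⟩-ideal : ∀ X → IdealOf↓ p ⟨ X ⟩
    ⟨⟩-ideal X = proj₁ , lower , joinClosed
      where
      lower : ∀ {x y} → x ≤ y → y ∈ ⟨ X ⟩ → x ∈ ⟨ X ⟩
      lower x≤y (y≤p , z , z∈φX , y≤z) = ≤-trans x≤y y≤p , z , z∈φX , ≤-trans x≤y y≤z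
      joinClosed : JoinClosed ⟨ X ⟩
      joinClosed (x≤p , z , z∈φX , x≤z) (y≤p , w , w∈φX , y≤w) =
        ∨-least x≤p y≤p , z ∨ w , φ-joinClosed z∈φX w∈φX ,
        ∨-least (≤-trans x≤z (x≤x∨y z w)) (≤-trans y≤w (y≤x∨y z w))

    ⟨⟩-⊇ : ∀ {X} → X ⊆ ↓ p → X ⊆ ⟨ X ⟩
    ⟨⟩-⊇ X⊆↓p {x} x∈X = X⊆↓p x∈X , x , φ-extensive x∈X , ≤-refl

    -- p ≤ z for a join z of points below p forces z = p.
    neighborhood⇒proper : ∀ {u} → Neighborhood p u → ProperIdealOf↓ p ⟨ ↓ p ∖ u ⟩
    neighborhood⇒proper {u} nbhd = ⟨⟩-ideal (↓ p ∖ u) , p , ≤-refl , p∉⟨↓p∖u⟩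
      where
      p∉⟨↓p∖u⟩ : p ∉ ⟨ ↓ p ∖ u ⟩
      p∉⟨↓p∖u⟩ (_ , z , z∈φ , p≤z) =
        nbhd (subst (_∈ φ (∁ u)) (antisym z≤p p≤z) (φ-mono proj₂ z∈φ))
        where
        z≤p : z ≤ p
        z≤p = JoinClosed⇒φ⊆ (↓-joinClosed p) (φ-mono proj₁ z∈φ)

  module Classical (em : ExcludedMiddle a) (p : A) where

    open GeneratedIdeal p

    ∖∖⊆ : ∀ (X Y : Pred A a) → X ∖ (X ∖ Y) ⊆ Y
    ∖∖⊆ _ _ (x∈X , x∉X∖Y) = decidable-stable em (λ x∉Y → x∉X∖Y (x∈X , x∉Y))

    φ̌-deflationary : ∀ {X} → φ̌ X ⊆ X
    φ̌-deflationary z∉φ∁X = decidable-stable em (λ z∉X → z∉φ∁X (φ-extensive z∉X))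

    ↓∖⟨↓∖⟩⊆ : ∀ {u} → ↓ p ∖ ⟨ ↓ p ∖ u ⟩ ⊆ u
    ↓∖⟨↓∖⟩⊆ {u} (x≤p , x∉⟨⟩) = ∖∖⊆ (↓ p) u (x≤p , λ x∈↓p∖u → x∉⟨⟩ (⟨⟩-⊇ proj₁ x∈↓p∖u))

    ↓∖-open : ∀ {I} → JoinClosed I → ↓ p ∖ I ⊆ φ̌ (↓ p ∖ I)
    ↓∖-open {I} cl (z≤p , z∉I) = neighborhood-of-joinClosed cl z∉I
      (λ (x≤z , x∉↓p∖I) → ∖∖⊆ (↓ p) I (≤-trans x≤z z≤p , x∉↓p∖I))

    ↓∖-neighborhood : ∀ {I} → IdealOf↓ p I → p ∉ I → Neighborhood p (↓ p ∖ I)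
    ↓∖-neighborhood (_ , _ , cl) p∉I = ↓∖-open cl (≤-refl , p∉I)

    ↓∖-clopen : ∀ {I} → IdealOf↓ p I → Clopen (↓ p ∖ I)
    ↓∖-clopen {I} (_ , lower , cl) =
      (φ⊆ , φ-extensive) , (φ̌-deflationary , ↓∖-open cl)
      where
      φ⊆ : φ (↓ p ∖ I) ⊆ ↓ p ∖ I
      φ⊆ z∈φ@(y , ys , (_ , y∉I) , _ , refl) =
        JoinClosed⇒φ⊆ (↓-joinClosed p) (φ-mono proj₁ z∈φ) ,
        λ z∈I → y∉I (lower (foldr-∨-seed y ys) z∈I)

    minimal⇒≐↓∖⟨↓∖⟩ : ∀ {u} → MinimalNeighborhood p u → u ≐ ↓ p ∖ ⟨ ↓ p ∖ u ⟩
    minimal⇒≐↓∖⟨↓∖⟩ {u} (nbhd , minimal) =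
      minimal _ (↓∖-neighborhood ideal (proper⇒∌ proper)) ↓∖⟨↓∖⟩⊆ , ↓∖⟨↓∖⟩⊆
      where
      proper : ProperIdealOf↓ p ⟨ ↓ p ∖ u ⟩
      proper = neighborhood⇒proper nbhd
      ideal : IdealOf↓ p ⟨ ↓ p ∖ u ⟩
      ideal = proj₁ proper

    minimal⇒maximal : ∀ {I} → ProperIdealOf↓ p I → MinimalNeighborhood p (↓ p ∖ I) →
                      MaximalProperIdealOf↓ p I
    minimal⇒maximal {I} properI (_ , minimal) = properI , maximal
      where
      maximal : ∀ J → ProperIdealOf↓ p J → I ⊆ J → J ⊆ I
      maximal J properJ@((J⊆↓p , _) , _) I⊆J {x} x∈J = ∖∖⊆ (↓ p) I (J⊆↓p x∈J , x∉↓p∖I)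
        where
        ↓p∖J⊆↓p∖I : ↓ p ∖ J ⊆ ↓ p ∖ I
        ↓p∖J⊆↓p∖I (y≤p , y∉J) = y≤p , λ y∈I → y∉J (I⊆J y∈I)
        ↓p∖I⊆↓p∖J : ↓ p ∖ I ⊆ ↓ p ∖ J
        ↓p∖I⊆↓p∖J = minimal (↓ p ∖ J) (↓∖-neighborhood (proj₁ properJ) (proper⇒∌ properJ)) ↓p∖J⊆↓p∖I
        x∉↓p∖I : x ∉ ↓ p ∖ I
        x∉↓p∖I x∈↓p∖I = proj₂ (↓p∖I⊆↓p∖J x∈↓p∖I) x∈J

    maximal⇒minimal : ∀ {I} → MaximalProperIdealOf↓ p I → MinimalNeighborhood p (↓ p ∖ I)
    maximal⇒minimal {I} (properI , maximal) =
      ↓∖-neighborhood (proj₁ properI) (proper⇒∌ properI) , minimal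
      where
      minimal : ∀ v → Neighborhood p v → v ⊆ ↓ p ∖ I → ↓ p ∖ I ⊆ v
      minimal v nbhd v⊆↓p∖I (x≤p , x∉I) = ↓∖⟨↓∖⟩⊆ (x≤p , λ x∈⟨⟩ → x∉I (⟨↓p∖v⟩⊆I x∈⟨⟩))
        where
        I⊆⟨↓p∖v⟩ : I ⊆ ⟨ ↓ p ∖ v ⟩
        I⊆⟨↓p∖v⟩ y∈I = ⟨⟩-⊇ proj₁ (proj₁ (proj₁ properI) y∈I , λ y∈v → proj₂ (v⊆↓p∖I y∈v) y∈I)
        ⟨↓p∖v⟩⊆I : ⟨ ↓ p ∖ v ⟩ ⊆ I
        ⟨↓p∖v⟩⊆I = maximal ⟨ ↓ p ∖ v ⟩ (neighborhood⇒proper nbhd) I⊆⟨↓p∖v⟩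

theorem8p2 : {a : Level} → ExcludedMiddle a →
    {A : Set a} (_≤_ : Rel A a) (_∨_ : Op₂ A) →
    IsJoinSemilattice _≡_ _≤_ _∨_ →
    (p : A) →
    let open JS _≤_ _∨_ in
    (∀ (u : Pred A a) →
        (MinimalNeighborhood p u
          → Σ (Pred A a) λ I → MaximalProperIdealOf↓ p I × (u ≐ (↓ p ∖ I)))
      × ((Σ (Pred A a) λ I → MaximalProperIdealOf↓ p I × (u ≐ (↓ p ∖ I)))
          → MinimalNeighborhood p u))
    × (∀ (u : Pred A a) → MinimalNeighborhood p u → Clopen u)
theorem8p2 {a} em {A} _≤_ _∨_ isJoinSemilattice p =
  (λ u → minimal⇒complement , complement⇒minimal) , (λ _ → minimal⇒clopen)
  where
  open JS _≤_ _∨_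
  open Neighborhoods isJoinSemilattice
  open GeneratedIdeal p
  open Classical em p

  minimal⇒complement : ∀ {u} → MinimalNeighborhood p u →
                       Σ (Pred A a) λ I → MaximalProperIdealOf↓ p I × (u ≐ (↓ p ∖ I))
  minimal⇒complement {u} minimalᵤ =
    ⟨ ↓ p ∖ u ⟩ ,
    minimal⇒maximal (neighborhood⇒proper (proj₁ minimalᵤ))
      (MinimalNeighborhood-resp-≐ u≐ minimalᵤ) ,
    u≐
    where u≐ = minimal⇒≐↓∖⟨↓∖⟩ minimalᵤ

  complement⇒minimal : ∀ {u} → (Σ (Pred A a) λ I → MaximalProperIdealOf↓ p I × (u ≐ (↓ p ∖ I))) →
                       MinimalNeighborhood p u
  complement⇒minimal (_ , maximalI , u≐) =
    MinimalNeighborhood-resp-≐ (≐-sym u≐) (maximal⇒minimal maximalI)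

  minimal⇒clopen : ∀ {u} → MinimalNeighborhood p u → Clopen u
  minimal⇒clopen minimalᵤ with _ , ((ideal , _) , _) , u≐ ← minimal⇒complement minimalᵤ =
    Clopen-resp-≐ (≐-sym u≐) (↓∖-clopen ideal)
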